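{- Let $m\ge 3$, let $n \ge 6$ be even, let $\ell\in\mathbb{Z}_n$ have the same parity as $m$, and let $k_0 = 1, k_1,\dots,k_{m-1} \in \mathbb{Z}_n$ all be coprime to $n$. Let $\Gamma = \mathcal{X}_a(m,n,[k_0,\dots,k_{m-1}],\ell)$ and assume there exists a vertex-transitive subgroup $G \le \mathrm{Aut}(\Gamma)$ preserving the $2$-factor $\mathcal{C}$. Then precisely one of the following holds: (1) $2k_i \in \{2,-2\}$ for all $i \in \mathbb{Z}_m$; or (2) $m$ is even, $2k_1 \notin \{2,-2\}$, $2k_i \in\{2,-2\}$ for each even $i \in \mathbb{Z}_m$, and $2k_i \in \{2k_1,-2k_1\}$ for each odd $i \in \mathbb{Z}_m$.
   Context: $\mathcal{X}_a(m,n,[k_0,\dots,k_{m-1}],\ell)$ is the graph with vertices $u_{i,j}$ ($i\in\mathbb{Z}_m$, $j\in\mathbb{Z}_n$) and edges: $u_{i,j}u_{i,j+k_i}$ for all $i,j$; $u_{i,j}u_{i+1,j}$ for integers $0\le i\le m-2$ and $j\equiv i\pmod 2$; $u_{m-1,j}u_{0,j+\ell}$ for $j\equiv m-1\pmod 2$. For $i\in\mathbb{Z}_m$, $C_i$ is the $n$-cycle induced on $V_i=\{u_{i,j}: j\in\mathbb{Z}_n\}$, and $\mathcal{C}=\{C_i\}$. A group preserves $\mathcal{C}$ if it maps cycles of $\mathcal{C}$ to cycles of $\mathcal{C}$. Arithmetic is in $\mathbb{Z}_n$; "$i$ even" refers to the representative $0\le i\le m-1$. -}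

module Defs where

open import Data.Nat using (ℕ; zero; suc; _+_; _*_; _∸_; _≤_; _<_; s≤s; z≤n; NonZero)
open import Data.Nat.DivMod using (_%_; _mod_)
open import Data.Fin using (Fin; toℕ) renaming (zero to fz; suc to fs)
open import Data.Product using (_×_; _,_; proj₁; ∃)
open import Data.Sum using (_⊎_)
open import Relation.Binary.PropositionalEquality using (_≡_)
open import Function.Bundles using (Inverse; _↔_)
open import Function.Properties.Inverse using (↔-refl; ↔-sym; ↔-trans)
open import Level using (0ℓ)
open import Relation.Unary using (Pred; _∈_)

module Zn (n : ℕ) .{{_ : NonZero n}} where
  [_] : ℕ → Fin n
  [ x ] = x mod n

  _⊕_ : Fin n → Fin n → Fin n
  a ⊕ b = [ toℕ a + toℕ b ]

  ⊖_ : Fin n → Fin n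
  ⊖ a = [ n ∸ toℕ a ]

  dbl : Fin n → Fin n
  dbl a = [ 2 * toℕ a ]

  _∈±_ : Fin n → Fin n → Set
  x ∈± y = (x ≡ y) ⊎ (x ≡ ⊖ y)

idx1 : (m : ℕ) → 3 ≤ m → Fin m
idx1 (suc zero) (s≤s ())
idx1 (suc (suc zero)) (s≤s (s≤s ()))
idx1 (suc (suc (suc m))) _ = fs fz

parity : ℕ → ℕ
parity x = x % 2

module Xa (m n : ℕ) .{{_ : NonZero n}} (k : Fin m → Fin n) (ℓ : Fin n) where
  open Zn n

  Vertex : Set
  Vertex = Fin m × Fin n

  data Edge : Vertex → Vertex → Set where
    cyc  : ∀ i j → Edge (i , j) (i , j ⊕ k i)
    rung : ∀ i i' j → suc (toℕ i) ≡ toℕ i' → parity (toℕ j) ≡ parity (toℕ i)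
         → Edge (i , j) (i' , j)
    wrap : ∀ i i' j → suc (toℕ i) ≡ m → toℕ i' ≡ 0 → parity (toℕ j) ≡ parity (toℕ i)
         → Edge (i , j) (i' , j ⊕ ℓ)

  Adj : Vertex → Vertex → Set
  Adj x y = Edge x y ⊎ Edge y x

  IsAut : Vertex ↔ Vertex → Set
  IsAut g = ∀ x y → (Adj x y → Adj (Inverse.to g x) (Inverse.to g y))
                  × (Adj (Inverse.to g x) (Inverse.to g y) → Adj x y)

  record IsAutSubgroup (G : Pred (Vertex ↔ Vertex) 0ℓ) : Set where
    field
      auts  : ∀ g → g ∈ G → IsAut g
      idG   : ↔-refl ∈ G
      compG : ∀ g h → g ∈ G → h ∈ G → ↔-trans g h ∈ G
      invG  : ∀ g → g ∈ G → ↔-sym g ∈ G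

  VertexTransitive : Pred (Vertex ↔ Vertex) 0ℓ → Set
  VertexTransitive G = ∀ x y → ∃ λ g → g ∈ G × Inverse.to g x ≡ y

  -- G maps each cycle C_i (on V_i = {u_{i,j}}) to some cycle C_{i'} of 𝒞
  Preserves𝒞 : Pred (Vertex ↔ Vertex) 0ℓ → Set
  Preserves𝒞 G = ∀ g → g ∈ G → ∀ (i : Fin m) → ∃ λ (i' : Fin m) →
                   ∀ (j : Fin n) → proj₁ (Inverse.to g (i , j)) ≡ i'

-- Every g ∈ G maps cycles of 𝒞 to cycles of 𝒞, hence rungs (edges between different cycles) to rungs and
-- non-backtracking walks inside a cycle to such walks, which always run in one direction.  At u_{0,0} there is
-- a detour: the rung up to u_{1,0}, two steps along C_1, and the rung back down to u_{0,2k_1}, a vertex that is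
-- also 2k_1 steps along C_0.  Vertex-transitivity carries it to every u_{i,i+1}, whose rung goes down to
-- C_{i-1}, and there it reads 2k_{i-1} = ±2k_1k_i.  With k_0 = 1 this gives 2 = ±2k_1² and 2k_i = ±2k_1^i, so
-- 2k_i is ±2 or ±2k_1 according to the parity of i; at i = 0 it reads 2k_{m-1} = ±2k_1, which forces m to be
-- even unless 2k_1 = ±2.  The walks do not backtrack because 2k_i ≠ 0, as k_i is a unit and n > 2.

module Submission where

open import Defs
open import Level using (0ℓ)
open import Data.Nat using (ℕ; zero; suc; _+_; _*_; _∸_; _^_; _≤_; _<_; s≤s; z≤n; NonZero; >-nonZero⁻¹)
open import Data.Nat.Properties
  using (≤-refl; ≤-trans; <-irrefl; <⇒≤; <⇒≱; suc-injective; 0≢1+n; 1+n≢n; m∸n+n≡m;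
         +-assoc; +-comm; +-identityʳ; +-suc; *-comm; *-assoc; *-identityʳ; *-distribʳ-+)
  renaming (_≟_ to _≟ℕ_)
open import Data.Nat.DivMod
  using (_%_; m%n%n≡m%n; %-distribˡ-+; %-distribˡ-*; [m+kn]%n≡m%n; n%n≡0; m%n<n; m%n≤n; m<n⇒m%n≡m;
         m∣n⇒o%n%m≡o%m)
open import Data.Nat.Divisibility using (_∣_; m%n≡0⇒n∣m; ∣⇒≤)
open import Data.Nat.Coprimality using (Coprime; coprime-divisor) renaming (sym to coprime-sym)
open import Data.Nat.Solver using (module +-*-Solver)
open import Data.Fin using (Fin; toℕ; fromℕ<)
open import Data.Fin.Properties using (toℕ-injective; toℕ<n; toℕ-fromℕ<)
open import Data.Product using (_×_; _,_; proj₁; proj₂; ∃)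
open import Data.Sum using (_⊎_; inj₁; inj₂)
open import Data.Empty using (⊥-elim)
open import Relation.Nullary using (¬_; Dec; yes; no)
open import Relation.Nullary.Decidable using (map′; _⊎-dec_)
open import Relation.Unary using (Pred; _∈_)
open import Relation.Binary.Bundles using (Setoid)
open import Relation.Binary.Structures using (IsEquivalence)
open import Relation.Binary.PropositionalEquality hiding ([_])
import Relation.Binary.Reasoning.Setoid as SetoidReasoning
open import Function.Bundles using (Inverse; _↔_)
open import Function.Properties.Inverse using (↔-sym)

parity-suc≢ : ∀ t → parity (suc t) ≢ parity t
parity-suc≢ zero ()
parity-suc≢ (suc t) e = parity-suc≢ t (sym e)

parity-0⊎1 : ∀ t → parity t ≡ 0 ⊎ parity t ≡ 1
parity-0⊎1 zero = inj₁ refl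
parity-0⊎1 (suc zero) = inj₂ refl
parity-0⊎1 (suc (suc t)) = parity-0⊎1 t

parity-suc-odd : ∀ t → parity t ≡ 1 → parity (suc t) ≡ 0
parity-suc-odd t odd with parity-0⊎1 (suc t)
... | inj₁ even = even
... | inj₂ odd' = ⊥-elim (parity-suc≢ t (trans odd' (sym odd)))

parity-+-cong : ∀ {a a' b b'} → parity a ≡ parity a' → parity b ≡ parity b' → parity (a + b) ≡ parity (a' + b')
parity-+-cong {a} {a'} {b} {b'} p q =
  trans (%-distribˡ-+ a b 2) (trans (cong₂ (λ u v → (u + v) % 2) p q) (sym (%-distribˡ-+ a' b' 2)))

parity-+-double : ∀ a c → parity (a + 2 * c) ≡ parity a
parity-+-double a c = trans (cong (λ z → parity (a + z)) (*-comm 2 c)) ([m+kn]%n≡m%n a c 2)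

parity-+-suc : ∀ t → parity (t + suc t) ≡ 1
parity-+-suc zero = refl
parity-+-suc (suc t) = trans (cong (λ z → parity (suc z)) (+-suc t (suc t))) (parity-+-suc t)

module Modular (n : ℕ) .{{_ : NonZero n}} where
  open Zn n

  infix 4 _≈_ _≈±_ _≈±?_

  record _≈_ (a b : ℕ) : Set where
    constructor mk≈
    field %-≡ : a % n ≡ b % n

  ≈-isEquivalence : IsEquivalence _≈_
  ≈-isEquivalence = record
    { refl = mk≈ refl
    ; sym = λ (mk≈ e) → mk≈ (sym e)
    ; trans = λ (mk≈ e) (mk≈ f) → mk≈ (trans e f)
    }

  open IsEquivalence ≈-isEquivalence public using ()
    renaming (refl to ≈-refl; sym to ≈-sym; trans to ≈-trans)

  ≈-setoid : Setoid 0ℓ 0ℓ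
  ≈-setoid = record { isEquivalence = ≈-isEquivalence }

  module ≈-Reasoning = SetoidReasoning ≈-setoid

  ≡⇒≈ : ∀ {a b} → a ≡ b → a ≈ b
  ≡⇒≈ e = mk≈ (cong (_% n) e)

  %-≈ : ∀ a → a % n ≈ a
  %-≈ a = mk≈ (m%n%n≡m%n a n)

  n≈0 : n ≈ 0
  n≈0 = mk≈ (trans (n%n≡0 n) (sym (m<n⇒m%n≡m (>-nonZero⁻¹ n))))

  ≈⇒≡ : ∀ {a b} → a < n → b < n → a ≈ b → a ≡ b
  ≈⇒≡ a<n b<n (mk≈ e) = trans (sym (m<n⇒m%n≡m a<n)) (trans e (m<n⇒m%n≡m b<n))

  +-≈ : ∀ {a b c d} → a ≈ b → c ≈ d → a + c ≈ b + d
  +-≈ {a} {b} {c} {d} (mk≈ p) (mk≈ q) =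
    mk≈ (trans (%-distribˡ-+ a c n) (trans (cong₂ (λ x y → (x + y) % n) p q) (sym (%-distribˡ-+ b d n))))

  *-≈ : ∀ {a b c d} → a ≈ b → c ≈ d → a * c ≈ b * d
  *-≈ {a} {b} {c} {d} (mk≈ p) (mk≈ q) =
    mk≈ (trans (%-distribˡ-* a c n) (trans (cong₂ (λ x y → (x * y) % n) p q) (sym (%-distribˡ-* b d n))))

  ∸-inverse : ∀ a → (n ∸ a % n) + a ≈ 0
  ∸-inverse a = begin
      (n ∸ a % n) + a      ≈⟨ +-≈ ≈-refl (≈-sym (%-≈ a)) ⟩
      (n ∸ a % n) + a % n  ≡⟨ m∸n+n≡m (m%n≤n a n) ⟩
      n                    ≈⟨ n≈0 ⟩
      0                    ∎
    where open ≈-Reasoning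

  +-cancelˡ-≈ : ∀ a {b c} → a + b ≈ a + c → b ≈ c
  +-cancelˡ-≈ a {b} {c} e = begin
      b                  ≈⟨ +-≈ (≈-sym (∸-inverse a)) ≈-refl ⟩
      (a⁻ + a) + b       ≡⟨ +-assoc a⁻ a b ⟩
      a⁻ + (a + b)       ≈⟨ +-≈ {a⁻} ≈-refl e ⟩
      a⁻ + (a + c)       ≡⟨ +-assoc a⁻ a c ⟨
      (a⁻ + a) + c       ≈⟨ +-≈ (∸-inverse a) ≈-refl ⟩
      c                  ∎
    where
      open ≈-Reasoning
      a⁻ = n ∸ a % n

  +-cancelʳ-≈ : ∀ a {b c} → b + a ≈ c + a → b ≈ c
  +-cancelʳ-≈ a {b} {c} e = +-cancelˡ-≈ a (≈-trans (≡⇒≈ (+-comm a b)) (≈-trans e (≡⇒≈ (+-comm c a))))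

  parity-≈ : 2 ∣ n → ∀ {a b} → a ≈ b → parity a ≡ parity b
  parity-≈ 2∣n {a} {b} (mk≈ e) =
    trans (sym (m∣n⇒o%n%m≡o%m 2 n a 2∣n)) (trans (cong parity e) (m∣n⇒o%n%m≡o%m 2 n b 2∣n))

  double≉0 : 3 ≤ n → ∀ {a} → Coprime a n → ¬ (2 * a ≈ 0)
  double≉0 3≤n {a} a⊥n (mk≈ e) = <⇒≱ 3≤n (∣⇒≤ (coprime-divisor (coprime-sym a⊥n) n∣a*2))
    where
      n∣a*2 : n ∣ a * 2
      n∣a*2 = m%n≡0⇒n∣m (a * 2) n (trans (cong (_% n) (*-comm a 2)) (trans e (m<n⇒m%n≡m (>-nonZero⁻¹ n))))

  toℕ-[] : ∀ a → toℕ [ a ] ≈ a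
  toℕ-[] a = ≈-trans (≡⇒≈ (toℕ-fromℕ< (m%n<n a n))) (%-≈ a)

  toℕ-injective-≈ : ∀ {i j : Fin n} → toℕ i ≈ toℕ j → i ≡ j
  toℕ-injective-≈ e = toℕ-injective (≈⇒≡ (toℕ<n _) (toℕ<n _) e)

  []-cong : ∀ {a b} → a ≈ b → [ a ] ≡ [ b ]
  []-cong {a} {b} e = toℕ-injective-≈ (≈-trans (toℕ-[] a) (≈-trans e (≈-sym (toℕ-[] b))))

  []-injective : ∀ {a b} → [ a ] ≡ [ b ] → a ≈ b
  []-injective {a} {b} e = ≈-trans (≈-sym (toℕ-[] a)) (≈-trans (≡⇒≈ (cong toℕ e)) (toℕ-[] b))

  data Direction : Set where
    forward backward : Direction

  reverse : Direction → Direction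
  reverse forward = backward
  reverse backward = forward

  infix 4 _≈_+[_]_

  _≈_+[_]_ : ℕ → ℕ → Direction → ℕ → Set
  b ≈ a +[ forward ] c = b ≈ a + c
  b ≈ a +[ backward ] c = b + c ≈ a

  +[]-zero : ∀ d a → a ≈ a +[ d ] 0
  +[]-zero forward a = ≡⇒≈ (sym (+-identityʳ a))
  +[]-zero backward a = ≡⇒≈ (+-identityʳ a)

  +[]-trans : ∀ d {a b e c c'} → b ≈ a +[ d ] c → e ≈ b +[ d ] c' → e ≈ a +[ d ] c' + c
  +[]-trans forward {a} {b} {e} {c} {c'} p q = begin
      e              ≈⟨ q ⟩
      b + c'         ≈⟨ +-≈ p ≈-refl ⟩
      a + c + c'     ≡⟨ +-assoc a c c' ⟩
      a + (c + c')   ≡⟨ cong (a +_) (+-comm c c') ⟩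
      a + (c' + c)   ∎
    where open ≈-Reasoning
  +[]-trans backward {a} {b} {e} {c} {c'} p q = begin
      e + (c' + c)   ≡⟨ +-assoc e c' c ⟨
      e + c' + c     ≈⟨ +-≈ q ≈-refl ⟩
      b + c          ≈⟨ p ⟩
      a              ∎
    where open ≈-Reasoning

  continue-or-backtrack : ∀ {a b e c} d d' → b ≈ a +[ d ] c → e ≈ b +[ d' ] c → d' ≡ d ⊎ e ≈ a
  continue-or-backtrack forward forward p q = inj₁ refl
  continue-or-backtrack backward backward p q = inj₁ refl
  continue-or-backtrack {c = c} forward backward p q = inj₂ (+-cancelʳ-≈ c (≈-trans q p))
  continue-or-backtrack backward forward p q = inj₂ (≈-trans q p)

  +[]-translate : ∀ d {a b a' b' c e} → b ≈ a +[ d ] c → b' ≈ b + e → a' ≈ a + e → b' ≈ a' +[ d ] c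
  +[]-translate forward {a} {b} {a'} {b'} {c} {e} p q r = begin
      b'             ≈⟨ q ⟩
      b + e          ≈⟨ +-≈ p ≈-refl ⟩
      a + c + e      ≡⟨ +-assoc a c e ⟩
      a + (c + e)    ≡⟨ cong (a +_) (+-comm c e) ⟩
      a + (e + c)    ≡⟨ +-assoc a e c ⟨
      a + e + c      ≈⟨ +-≈ r ≈-refl ⟨
      a' + c         ∎
    where open ≈-Reasoning
  +[]-translate backward {a} {b} {a'} {b'} {c} {e} p q r = begin
      b' + c         ≈⟨ +-≈ q ≈-refl ⟩
      b + e + c      ≡⟨ +-assoc b e c ⟩
      b + (e + c)    ≡⟨ cong (b +_) (+-comm e c) ⟩
      b + (c + e)    ≡⟨ +-assoc b c e ⟨
      b + c + e      ≈⟨ +-≈ p ≈-refl ⟩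
      a + e          ≈⟨ r ⟨
      a'             ∎
    where open ≈-Reasoning

  +[]-parity : 2 ∣ n → ∀ d {a b} c → b ≈ a +[ d ] 2 * c → parity b ≡ parity a
  +[]-parity 2∣n forward {a} {b} c p = trans (parity-≈ 2∣n p) (parity-+-double a c)
  +[]-parity 2∣n backward {a} {b} c p = sym (trans (sym (parity-≈ 2∣n p)) (parity-+-double b c))

  _≈±_ : ℕ → ℕ → Set
  a ≈± b = a ≈ b ⊎ a + b ≈ 0

  ≈±-isEquivalence : IsEquivalence _≈±_
  ≈±-isEquivalence = record { refl = inj₁ ≈-refl ; sym = ≈±-sym ; trans = ≈±-trans }
    where
      ≈±-sym : ∀ {a b} → a ≈± b → b ≈± a
      ≈±-sym (inj₁ e) = inj₁ (≈-sym e)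
      ≈±-sym {a} {b} (inj₂ e) = inj₂ (≈-trans (≡⇒≈ (+-comm b a)) e)
      ≈±-trans : ∀ {a b c} → a ≈± b → b ≈± c → a ≈± c
      ≈±-trans (inj₁ e) (inj₁ f) = inj₁ (≈-trans e f)
      ≈±-trans (inj₁ e) (inj₂ f) = inj₂ (≈-trans (+-≈ e ≈-refl) f)
      ≈±-trans {a} (inj₂ e) (inj₁ f) = inj₂ (≈-trans (+-≈ {a} ≈-refl (≈-sym f)) e)
      ≈±-trans {a} {b} {c} (inj₂ e) (inj₂ f) = inj₁ (begin
          a                ≡⟨ +-identityʳ a ⟨
          a + 0            ≈⟨ +-≈ {a} ≈-refl f ⟨
          a + (b + c)      ≡⟨ +-assoc a b c ⟨
          a + b + c        ≈⟨ +-≈ e ≈-refl ⟩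
          c                ∎)
        where open ≈-Reasoning

  open IsEquivalence ≈±-isEquivalence public using ()
    renaming (refl to ≈±-refl; reflexive to ≈±-reflexive; sym to ≈±-sym; trans to ≈±-trans)

  ≈±-setoid : Setoid 0ℓ 0ℓ
  ≈±-setoid = record { isEquivalence = ≈±-isEquivalence }

  module ≈±-Reasoning = SetoidReasoning ≈±-setoid

  ≈±-*-congʳ : ∀ c {a b} → a ≈± b → a * c ≈± b * c
  ≈±-*-congʳ c (inj₁ e) = inj₁ (*-≈ e ≈-refl)
  ≈±-*-congʳ c {a} {b} (inj₂ e) = inj₂ (≈-trans (≡⇒≈ (sym (*-distribʳ-+ c a b))) (*-≈ e ≈-refl))

  _≈±?_ : ∀ a b → Dec (a ≈± b)
  a ≈±? b = map′ mk≈ _≈_.%-≡ (a % n ≟ℕ b % n) ⊎-dec map′ mk≈ _≈_.%-≡ ((a + b) % n ≟ℕ 0 % n)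

  ≈±-power-parity : ∀ {s} → 2 ≈± 2 * (s * s) → ∀ t → 2 * s ^ t ≈± 2 * s ^ parity t
  ≈±-power-parity _ zero = ≈±-refl
  ≈±-power-parity _ (suc zero) = ≈±-refl
  ≈±-power-parity {s} 2≈±2s² (suc (suc t)) = begin
      2 * s ^ (2 + t)
        ≡⟨ solve 2 (λ a b → con 2 :* (a :* (a :* b)) := con 2 :* b :* (a :* a)) refl s (s ^ t) ⟩
      2 * s ^ t * (s * s)          ≈⟨ ≈±-*-congʳ (s * s) (≈±-power-parity 2≈±2s² t) ⟩
      2 * s ^ parity t * (s * s)
        ≡⟨ solve 2 (λ a b → con 2 :* b :* (a :* a) := con 2 :* (a :* a) :* b) refl s (s ^ parity t) ⟩
      2 * (s * s) * s ^ parity t   ≈⟨ ≈±-*-congʳ (s ^ parity t) (≈±-sym 2≈±2s²) ⟩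
      2 * s ^ parity t             ∎
    where
      open ≈±-Reasoning
      open +-*-Solver

  +[]-unique : ∀ d d' {a b c c'} → b ≈ a +[ d ] c → b ≈ a +[ d' ] c' → c ≈± c'
  +[]-unique forward forward {a} p q = inj₁ (+-cancelˡ-≈ a (≈-trans (≈-sym p) q))
  +[]-unique backward backward {a} {b} p q = inj₁ (+-cancelˡ-≈ b (≈-trans p (≈-sym q)))
  +[]-unique forward backward {a} {b} {c} {c'} p q = inj₂ (+-cancelˡ-≈ a (begin
      a + (c + c')     ≡⟨ +-assoc a c c' ⟨
      a + c + c'       ≈⟨ +-≈ p ≈-refl ⟨
      b + c'           ≈⟨ q ⟩
      a                ≡⟨ +-identityʳ a ⟨
      a + 0            ∎))
    where open ≈-Reasoning
  +[]-unique backward forward p q = ≈±-sym (+[]-unique forward backward q p)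

  ≈±⇒∈± : ∀ {a b} → a ≈± b → [ a ] ∈± [ b ]
  ≈±⇒∈± (inj₁ e) = inj₁ ([]-cong e)
  ≈±⇒∈± {a} {b} (inj₂ e) = inj₂ ([]-cong (+-cancelʳ-≈ b (begin
      a + b                        ≈⟨ e ⟩
      0                            ≈⟨ n≈0 ⟨
      n                            ≡⟨ m∸n+n≡m (<⇒≤ (toℕ<n [ b ])) ⟨
      (n ∸ toℕ [ b ]) + toℕ [ b ]  ≈⟨ +-≈ {n ∸ toℕ [ b ]} ≈-refl (toℕ-[] b) ⟩
      (n ∸ toℕ [ b ]) + b          ∎)))
    where open ≈-Reasoning

  ∈±⇒≈± : ∀ {a b} → [ a ] ∈± [ b ] → a ≈± b
  ∈±⇒≈± (inj₁ e) = inj₁ ([]-injective e)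
  ∈±⇒≈± {a} {b} (inj₂ e) = inj₂ (begin
      a + b                        ≈⟨ +-≈ ([]-injective e) (≈-sym (toℕ-[] b)) ⟩
      (n ∸ toℕ [ b ]) + toℕ [ b ]  ≡⟨ m∸n+n≡m (<⇒≤ (toℕ<n [ b ])) ⟩
      n                            ≈⟨ n≈0 ⟩
      0                            ∎)
    where open ≈-Reasoning

module Layers (m n : ℕ) .{{_ : NonZero n}} (k : Fin m → Fin n) (ℓ : Fin n)
              (1<m : 1 < m) (2∣n : 2 ∣ n) (ℓ-parity : parity (toℕ ℓ) ≡ parity m) where
  open Zn n
  open Xa m n k ℓ
  open Modular n

  layer : Vertex → Fin m
  layer = proj₁

  pos : Vertex → ℕ
  pos v = toℕ (proj₂ v)

  K : Fin m → ℕ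
  K i = toℕ (k i)

  vertex-≈ : ∀ {a b} → layer a ≡ layer b → pos a ≈ pos b → a ≡ b
  vertex-≈ e p = cong₂ _,_ e (toℕ-injective-≈ p)

  CycleAdj RungAdj : Vertex → Vertex → Set
  CycleAdj x y = Adj x y × layer x ≡ layer y
  RungAdj x y = Adj x y × layer x ≢ layer y

  -- u_{i,j} has its rung going up to C_{i+1} exactly when j ≡ i (mod 2).
  Ascending : Vertex → Set
  Ascending x = parity (pos x) ≡ parity (toℕ (layer x))

  Precedes : Fin m → Fin m → Set
  Precedes p i = toℕ i ≡ suc (toℕ p) ⊎ (toℕ i ≡ 0 × suc (toℕ p) ≡ m)

  rungShift : Fin m → ℕ
  rungShift i with suc (toℕ i) ≟ℕ m
  ... | yes _ = toℕ ℓ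
  ... | no _ = 0

  rungShift-last : ∀ i → suc (toℕ i) ≡ m → rungShift i ≡ toℕ ℓ
  rungShift-last i last with suc (toℕ i) ≟ℕ m
  ... | yes _ = refl
  ... | no ¬last = ⊥-elim (¬last last)

  rungShift-inner : ∀ i (i' : Fin m) → suc (toℕ i) ≡ toℕ i' → rungShift i ≡ 0
  rungShift-inner i i' next with suc (toℕ i) ≟ℕ m
  ... | yes last = ⊥-elim (<-irrefl (trans (sym next) last) (toℕ<n i'))
  ... | no _ = refl

  cycleAdj-step : ∀ {a b} → CycleAdj a b → layer b ≡ layer a × ∃ λ d → pos b ≈ pos a +[ d ] K (layer a)
  cycleAdj-step (inj₁ (cyc i j) , _) = refl , forward , toℕ-[] _
  cycleAdj-step (inj₂ (cyc i j) , _) = refl , backward , ≈-sym (toℕ-[] _)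
  cycleAdj-step (inj₁ (rung i i' j next _) , same) = ⊥-elim (1+n≢n (trans next (cong toℕ (sym same))))
  cycleAdj-step (inj₂ (rung i i' j next _) , same) = ⊥-elim (1+n≢n (trans next (cong toℕ same)))
  cycleAdj-step (inj₁ (wrap i i' j last first _) , same) =
    ⊥-elim (<-irrefl (trans (sym (cong suc (trans (cong toℕ same) first))) last) 1<m)
  cycleAdj-step (inj₂ (wrap i i' j last first _) , same) =
    ⊥-elim (<-irrefl (trans (sym (cong suc (trans (cong toℕ (sym same)) first))) last) 1<m)

  ascending-rung : ∀ {a b} → Ascending a → RungAdj a b → pos b ≈ pos a + rungShift (layer a)
  ascending-rung _ (inj₁ (cyc i j) , different) = ⊥-elim (different refl)
  ascending-rung _ (inj₂ (cyc i j) , different) = ⊥-elim (different refl)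
  ascending-rung _ (inj₁ (rung i i' j next _) , _) =
    ≡⇒≈ (trans (sym (+-identityʳ _)) (cong (toℕ j +_) (sym (rungShift-inner i i' next))))
  ascending-rung _ (inj₁ (wrap i i' j last _ _) , _) =
    ≈-trans (toℕ-[] _) (≡⇒≈ (cong (toℕ j +_) (sym (rungShift-last i last))))
  ascending-rung asc (inj₂ (rung i i' j next j~i) , _) =
    ⊥-elim (parity-suc≢ (toℕ i) (trans (cong parity next) (trans (sym asc) j~i)))
  ascending-rung asc (inj₂ (wrap i i' j last first j~i) , _) = ⊥-elim (0≢1+n (begin
      0                             ≡⟨ cong parity first ⟨
      parity (toℕ i')               ≡⟨ asc ⟨
      parity (toℕ (j ⊕ ℓ))          ≡⟨ parity-≈ 2∣n (toℕ-[] _) ⟩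
      parity (toℕ j + toℕ ℓ)        ≡⟨ parity-+-cong {toℕ j} {toℕ i} {toℕ ℓ} j~i ℓ~1+i ⟩
      parity (toℕ i + suc (toℕ i))  ≡⟨ parity-+-suc (toℕ i) ⟩
      1                             ∎))
    where
      open ≡-Reasoning
      ℓ~1+i : parity (toℕ ℓ) ≡ parity (suc (toℕ i))
      ℓ~1+i = trans ℓ-parity (cong parity (sym last))

  descending-rung : ∀ {a b} → ¬ Ascending a → RungAdj a b →
                    Precedes (layer b) (layer a) × pos a ≈ pos b + rungShift (layer b) × Ascending b
  descending-rung _ (inj₁ (cyc i j) , different) = ⊥-elim (different refl)
  descending-rung _ (inj₂ (cyc i j) , different) = ⊥-elim (different refl)
  descending-rung desc (inj₁ (rung i i' j _ j~i) , _) = ⊥-elim (desc j~i)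
  descending-rung desc (inj₁ (wrap i i' j _ _ j~i) , _) = ⊥-elim (desc j~i)
  descending-rung _ (inj₂ (rung i i' j next j~i) , _) =
    inj₁ (sym next) , ≡⇒≈ (trans (sym (+-identityʳ _)) (cong (toℕ j +_) (sym (rungShift-inner i i' next)))) , j~i
  descending-rung _ (inj₂ (wrap i i' j last first j~i) , _) =
    inj₂ (first , last) , ≈-trans (toℕ-[] _) (≡⇒≈ (cong (toℕ j +_) (sym (rungShift-last i last)))) , j~i

  record CycleWalk (L : ℕ) (f : ℕ → Vertex) : Set where
    field
      step : ∀ t → t < L → CycleAdj (f t) (f (suc t))
      nonBacktracking : ∀ t → suc t < L → f (suc (suc t)) ≢ f t

  +[K]-cong : ∀ d {a b i i'} → i ≡ i' → b ≈ a +[ d ] K i → b ≈ a +[ d ] K i'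
  +[K]-cong d refl p = p

  cycleWalk-direction : ∀ {L f} → CycleWalk L f → ∀ t → t < L →
    layer (f (suc t)) ≡ layer (f 0) × ∃ λ d →
      pos (f t) ≈ pos (f 0) +[ d ] t * K (layer (f 0)) × pos (f (suc t)) ≈ pos (f t) +[ d ] K (layer (f 0))
  cycleWalk-direction {f = f} walk zero 0<L with cycleAdj-step (CycleWalk.step walk zero 0<L)
  ... | same , d , move = same , d , +[]-zero d (pos (f 0)) , move
  cycleWalk-direction {f = f} walk (suc t) t<L
    with cycleWalk-direction walk t (<⇒≤ t<L) | cycleAdj-step (CycleWalk.step walk (suc t) t<L)
  ... | same , d , to-t , step-t | same' , d' , move
    with continue-or-backtrack d d' step-t (+[K]-cong d' same move)
  ... | inj₁ refl = trans same' same , d , +[]-trans d to-t step-t , +[K]-cong d same move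
  ... | inj₂ back = ⊥-elim (CycleWalk.nonBacktracking walk t t<L (vertex-≈ (trans same' same-t) back))
    where
      same-t : layer (f (suc t)) ≡ layer (f t)
      same-t = proj₁ (cycleAdj-step (CycleWalk.step walk t (<⇒≤ t<L)))

  cycleWalk-displacement : ∀ {L f} → CycleWalk L f →
    layer (f L) ≡ layer (f 0) × ∃ λ d → pos (f L) ≈ pos (f 0) +[ d ] L * K (layer (f 0))
  cycleWalk-displacement {zero} {f} _ = refl , forward , +[]-zero forward (pos (f 0))
  cycleWalk-displacement {suc L} walk with cycleWalk-direction walk L ≤-refl
  ... | same , d , to-L , last-step = same , d , +[]-trans d to-L last-step

  record Detour (s : ℕ) (x : Vertex) : Set where
    field
      short long : ℕ → Vertex
      short-walk : CycleWalk 2 short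
      long-walk : CycleWalk (2 * s) long
      long-start : long 0 ≡ x
      first-rung : RungAdj x (short 0)
      last-rung : RungAdj (short 2) (long (2 * s))

  record PreservesCycles (φ : Vertex → Vertex) : Set where
    field
      adjacent : ∀ {x y} → Adj x y → Adj (φ x) (φ y)
      injective : ∀ {x y} → φ x ≡ φ y → x ≡ y
      sameLayer : ∀ {x y} → layer x ≡ layer y → layer (φ x) ≡ layer (φ y)
      sameLayer⁻ : ∀ {x y} → layer (φ x) ≡ layer (φ y) → layer x ≡ layer y

  module _ {φ : Vertex → Vertex} (φ-preserves : PreservesCycles φ) where
    open PreservesCycles φ-preserves

    cycleWalk-map : ∀ {L f} → CycleWalk L f → CycleWalk L (λ t → φ (f t))
    cycleWalk-map walk = record
      { step = λ t t<L → let (adj , same) = CycleWalk.step walk t t<L in adjacent adj , sameLayer same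
      ; nonBacktracking = λ t t<L back → CycleWalk.nonBacktracking walk t t<L (injective back)
      }

    rungAdj-map : ∀ {x y} → RungAdj x y → RungAdj (φ x) (φ y)
    rungAdj-map (adj , different) = adjacent adj , λ same → different (sameLayer⁻ same)

    detour-map : ∀ {s x} → Detour s x → Detour s (φ x)
    detour-map detour = record
      { short = λ t → φ (short t)
      ; long = λ t → φ (long t)
      ; short-walk = cycleWalk-map short-walk
      ; long-walk = cycleWalk-map long-walk
      ; long-start = cong φ long-start
      ; first-rung = rungAdj-map first-rung
      ; last-rung = rungAdj-map last-rung
      }
      where open Detour detour

  member-preservesCycles : ∀ {G} → IsAutSubgroup G → Preserves𝒞 G → ∀ {g} → g ∈ G →
                           PreservesCycles (Inverse.to g)
  member-preservesCycles {G} subgroup preserves {g} g∈G = record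
    { adjacent = λ {x} {y} → proj₁ (IsAutSubgroup.auts subgroup g g∈G x y)
    ; injective = λ {x} {y} e →
        trans (sym (Inverse.strictlyInverseʳ g x)) (trans (cong (Inverse.from g) e) (Inverse.strictlyInverseʳ g y))
    ; sameLayer = sameLayer g g∈G
    ; sameLayer⁻ = λ {x} {y} e →
        subst₂ (λ a b → layer a ≡ layer b) (Inverse.strictlyInverseʳ g x) (Inverse.strictlyInverseʳ g y)
          (sameLayer (↔-sym g) (IsAutSubgroup.invG subgroup g g∈G) e)
    }
    where
      sameLayer : ∀ h → h ∈ G → ∀ {x y} → layer x ≡ layer y → layer (Inverse.to h x) ≡ layer (Inverse.to h y)
      sameLayer h h∈G {i , j} {.i , j'} refl with preserves h h∈G i
      ... | i' , onto-i' = trans (onto-i' j) (sym (onto-i' j'))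

  -- The end y of the long walk is 2k_p away from x through the two rungs and the short walk, and 2s·k_i
  -- away along the long walk.
  detour-recurrence : ∀ {s x} → ¬ Ascending x → Detour s x →
                      ∃ λ p → Precedes p (layer x) × 2 * K p ≈± 2 * s * K (layer x)
  detour-recurrence {s} descending record
    { short = short ; long = long ; short-walk = short-walk ; long-walk = long-walk
    ; long-start = refl ; first-rung = first-rung ; last-rung = last-rung }
    with descending-rung descending first-rung | cycleWalk-displacement short-walk
       | cycleWalk-displacement long-walk
  ... | precedes , x≈w+r , w-ascending | same , d , end≈w±2k | _ , d' , y≈x±2sk =
    layer (short 0) , precedes , +[]-unique d d' (+[]-translate d end≈w±2k y≈end+r x≈w+r) y≈x±2sk
    where
      end-ascending : Ascending (short 2)
      end-ascending = trans (+[]-parity 2∣n d (K (layer (short 0))) end≈w±2k)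
                            (trans w-ascending (cong (λ i → parity (toℕ i)) (sym same)))
      y≈end+r : pos (long (2 * s)) ≈ pos (short 2) + rungShift (layer (short 0))
      y≈end+r = subst (λ i → pos (long (2 * s)) ≈ pos (short 2) + rungShift i) same
                      (ascending-rung end-ascending last-rung)

  straightWalk : Fin m → ℕ → Vertex
  straightWalk i t = (i , [ t * K i ])

  straightWalk-isCycleWalk : ∀ {i} → ¬ (2 * K i ≈ 0) → ∀ L → CycleWalk L (straightWalk i)
  straightWalk-isCycleWalk {i} 2k≉0 L = record { step = step ; nonBacktracking = nonBacktracking }
    where
      open ≈-Reasoning
      step : ∀ t → t < L → CycleAdj (straightWalk i t) (straightWalk i (suc t))
      step t _ = inj₁ (subst (λ j → Edge (i , [ t * K i ]) (i , j)) ([]-cong next) (cyc i [ t * K i ])) , refl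
        where
          next : toℕ [ t * K i ] + K i ≈ suc t * K i
          next = begin
            toℕ [ t * K i ] + K i  ≈⟨ +-≈ (toℕ-[] (t * K i)) ≈-refl ⟩
            t * K i + K i          ≡⟨ +-comm (t * K i) (K i) ⟩
            suc t * K i            ∎
      nonBacktracking : ∀ t → suc t < L → straightWalk i (suc (suc t)) ≢ straightWalk i t
      nonBacktracking t _ back = 2k≉0 (+-cancelʳ-≈ (t * K i) (begin
          2 * K i + t * K i    ≡⟨ *-distribʳ-+ (K i) 2 t ⟨
          (2 + t) * K i        ≈⟨ []-injective (cong proj₂ back) ⟩
          t * K i              ∎))

  parity-[]-double : ∀ c → parity (toℕ [ 2 * c ]) ≡ 0
  parity-[]-double c = trans (parity-≈ 2∣n (toℕ-[] (2 * c))) (parity-+-double 0 c)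

  detour-at-origin : (o one : Fin m) → toℕ o ≡ 0 → toℕ one ≡ 1 → K o ≡ 1 → (∀ i → ¬ (2 * K i ≈ 0)) →
                     Detour (K one) (o , [ 0 ])
  detour-at-origin o one o≡0 one≡1 k₀≡1 2k≉0 = record
    { short = straightWalk one
    ; long = straightWalk o
    ; short-walk = straightWalk-isCycleWalk (2k≉0 one) 2
    ; long-walk = straightWalk-isCycleWalk (2k≉0 o) (2 * K one)
    ; long-start = refl
    ; first-rung = inj₁ (rung o one [ 0 ] o→one (trans (parity-[]-double 0) (cong parity (sym o≡0)))) , o≢one
    ; last-rung = inj₂ (subst (λ j → Edge (o , [ 2 * K one * K o ]) (one , j)) (cong [_] 2k₁k₀≡2k₁)
                         (rung o one [ 2 * K one * K o ] o→one parity-end))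
                , λ e → o≢one (sym e)
    }
    where
      o→one : suc (toℕ o) ≡ toℕ one
      o→one = trans (cong suc o≡0) (sym one≡1)
      o≢one : o ≢ one
      o≢one e = 0≢1+n (trans (sym o≡0) (trans (cong toℕ e) one≡1))
      2k₁k₀≡2k₁ : 2 * K one * K o ≡ 2 * K one
      2k₁k₀≡2k₁ = trans (cong (2 * K one *_) k₀≡1) (*-identityʳ (2 * K one))
      parity-end : parity (toℕ [ 2 * K one * K o ]) ≡ parity (toℕ o)
      parity-end = trans (cong (λ c → parity (toℕ [ c ])) (*-assoc 2 (K one) (K o)))
                         (trans (parity-[]-double (K one * K o)) (cong parity (sym o≡0)))

toℕ-idx1 : ∀ m (3≤m : 3 ≤ m) → toℕ (idx1 m 3≤m) ≡ 1
toℕ-idx1 (suc zero) (s≤s ())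
toℕ-idx1 (suc (suc zero)) (s≤s (s≤s ()))
toℕ-idx1 (suc (suc (suc m))) _ = refl

module Classification
  (m n : ℕ) (3≤m : 3 ≤ m) (6≤n : 6 ≤ n) (n-even : parity n ≡ 0) .{{_ : NonZero n}}
  (k : Fin m → Fin n) (ℓ : Fin n) (ℓ-parity : parity (toℕ ℓ) ≡ parity m)
  (k₀≡1 : ∀ (i : Fin m) → toℕ i ≡ 0 → toℕ (k i) ≡ 1)
  (k-coprime : ∀ (i : Fin m) → Coprime (toℕ (k i)) n)
  (G : Pred (Xa.Vertex m n k ℓ ↔ Xa.Vertex m n k ℓ) 0ℓ) (subgroup : Xa.IsAutSubgroup m n k ℓ G)
  (transitive : Xa.VertexTransitive m n k ℓ G) (preserves : Xa.Preserves𝒞 m n k ℓ G)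
  where
  open Zn n
  open Xa m n k ℓ
  open Modular n

  2∣n : 2 ∣ n
  2∣n = m%n≡0⇒n∣m n 2 n-even

  open Layers m n k ℓ (≤-trans (s≤s (s≤s z≤n)) 3≤m) 2∣n ℓ-parity public

  o one : Fin m
  o = fromℕ< (≤-trans (s≤s z≤n) 3≤m)
  one = idx1 m 3≤m

  o≡0 : toℕ o ≡ 0
  o≡0 = toℕ-fromℕ< (≤-trans (s≤s z≤n) 3≤m)

  s : ℕ
  s = K one

  detour-everywhere : ∀ x → Detour s x
  detour-everywhere x with transitive (o , [ 0 ]) x
  ... | g , g∈G , refl = detour-map (member-preservesCycles subgroup preserves g∈G)
    (detour-at-origin o one o≡0 (toℕ-idx1 m 3≤m) (k₀≡1 o o≡0)
      (λ i → double≉0 (≤-trans (s≤s (s≤s (s≤s z≤n))) 6≤n) (k-coprime i)))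

  recurrence : ∀ i → ∃ λ p → Precedes p i × 2 * K p ≈± 2 * s * K i
  recurrence i = detour-recurrence descending (detour-everywhere (i , [ suc (toℕ i) ]))
    where
      descending : ¬ Ascending (i , [ suc (toℕ i) ])
      descending asc = parity-suc≢ (toℕ i) (trans (sym (parity-≈ 2∣n (toℕ-[] (suc (toℕ i))))) asc)

  double-k-one : 2 ≈± 2 * (s * s)
  double-k-one with recurrence one
  ... | p , inj₁ one≡1+p , 2kp≈±2s² = begin
      2              ≡⟨ cong (2 *_) (k₀≡1 p (suc-injective (trans (sym one≡1+p) (toℕ-idx1 m 3≤m)))) ⟨
      2 * K p        ≈⟨ 2kp≈±2s² ⟩
      2 * s * s      ≡⟨ *-assoc 2 s s ⟩
      2 * (s * s)    ∎
    where open ≈±-Reasoning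
  ... | p , inj₂ (one≡0 , _) , _ = ⊥-elim (0≢1+n (trans (sym one≡0) (toℕ-idx1 m 3≤m)))

  double-k-power : ∀ t i → toℕ i ≡ t → 2 * K i ≈± 2 * s ^ t
  double-k-power zero i i≡0 = ≈±-reflexive (cong (2 *_) (k₀≡1 i i≡0))
  double-k-power (suc t) i i≡1+t with recurrence i
  ... | p , inj₂ (i≡0 , _) , _ = ⊥-elim (0≢1+n (trans (sym i≡0) i≡1+t))
  ... | p , inj₁ i≡1+p , 2kp≈±2sk = begin
      2 * K i                ≈⟨ ≈±-*-congʳ (K i) double-k-one ⟩
      2 * (s * s) * K i      ≡⟨ solve 2 (λ a b → con 2 :* (a :* a) :* b := con 2 :* a :* b :* a) refl s (K i) ⟩
      2 * s * K i * s        ≈⟨ ≈±-*-congʳ s (≈±-sym 2kp≈±2sk) ⟩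
      2 * K p * s            ≈⟨ ≈±-*-congʳ s (double-k-power t p (suc-injective (trans (sym i≡1+p) i≡1+t))) ⟩
      2 * s ^ t * s          ≡⟨ solve 2 (λ a b → con 2 :* b :* a := con 2 :* (a :* b)) refl s (s ^ t) ⟩
      2 * s ^ suc t          ∎
    where
      open ≈±-Reasoning
      open +-*-Solver

  double-k-even : ∀ i → parity (toℕ i) ≡ 0 → 2 * K i ≈± 2
  double-k-even i even = ≈±-trans (double-k-power (toℕ i) i refl)
    (subst (λ e → 2 * s ^ toℕ i ≈± 2 * s ^ e) even (≈±-power-parity double-k-one (toℕ i)))

  double-k-odd : ∀ i → parity (toℕ i) ≡ 1 → 2 * K i ≈± 2 * s
  double-k-odd i odd = ≈±-trans (double-k-power (toℕ i) i refl)
    (subst (λ e → 2 * s ^ toℕ i ≈± 2 * e) (trans (cong (s ^_) odd) (*-identityʳ s))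
      (≈±-power-parity double-k-one (toℕ i)))

  double-k-≈±2 : 2 * s ≈± 2 → ∀ i → 2 * K i ≈± 2
  double-k-≈±2 2s≈±2 i with parity-0⊎1 (toℕ i)
  ... | inj₁ even = double-k-even i even
  ... | inj₂ odd = ≈±-trans (double-k-odd i odd) 2s≈±2

  m-even : ¬ (2 * s ≈± 2) → parity m ≡ 0
  m-even 2s≉±2 with recurrence o
  ... | p , inj₁ 0≡1+p , _ = ⊥-elim (0≢1+n (trans (sym o≡0) 0≡1+p))
  ... | p , inj₂ (_ , 1+p≡m) , 2kp≈±2sk₀ with parity-0⊎1 (toℕ p)
  ... | inj₂ odd = trans (cong parity (sym 1+p≡m)) (parity-suc-odd (toℕ p) odd)
  ... | inj₁ even = ⊥-elim (2s≉±2 (begin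
      2 * s        ≡⟨ *-identityʳ (2 * s) ⟨
      2 * s * 1    ≡⟨ cong (2 * s *_) (k₀≡1 o o≡0) ⟨
      2 * s * K o  ≈⟨ 2kp≈±2sk₀ ⟨
      2 * K p      ≈⟨ double-k-even p even ⟩
      2            ∎))
    where open ≈±-Reasoning

  Condition1 Condition2 : Set
  Condition1 = ∀ (i : Fin m) → dbl (k i) ∈± [ 2 ]
  Condition2 = (parity m ≡ 0) × ¬ (dbl (k one) ∈± [ 2 ])
             × (∀ (i : Fin m) → parity (toℕ i) ≡ 0 → dbl (k i) ∈± [ 2 ])
             × (∀ (i : Fin m) → parity (toℕ i) ≡ 1 → dbl (k i) ∈± dbl (k one))

proposition5p6 : (m n : ℕ) → (h3 : 3 ≤ m) → 6 ≤ n → parity n ≡ 0 → .{{_ : NonZero n}}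
  → (k : Fin m → Fin n) → (ℓ : Fin n) → parity (toℕ ℓ) ≡ parity m
  → (∀ (i : Fin m) → toℕ i ≡ 0 → toℕ (k i) ≡ 1)
  → (∀ (i : Fin m) → Coprime (toℕ (k i)) n)
  → (G : Pred (Xa.Vertex m n k ℓ ↔ Xa.Vertex m n k ℓ) 0ℓ)
  → Xa.IsAutSubgroup m n k ℓ G → Xa.VertexTransitive m n k ℓ G → Xa.Preserves𝒞 m n k ℓ G
  → let open Zn n
        h1 = idx1 m h3
        P1 = ∀ (i : Fin m) → dbl (k i) ∈± [ 2 ]
        P2 = (parity m ≡ 0) × ¬ (dbl (k h1) ∈± [ 2 ])
             × (∀ (i : Fin m) → parity (toℕ i) ≡ 0 → dbl (k i) ∈± [ 2 ])
             × (∀ (i : Fin m) → parity (toℕ i) ≡ 1 → dbl (k i) ∈± dbl (k h1))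
    in (P1 ⊎ P2) × ¬ (P1 × P2)
proposition5p6 m n 3≤m 6≤n n-even k ℓ ℓ-parity k₀≡1 k-coprime G subgroup transitive preserves =
  by-cases (2 * s ≈±? 2) , λ (condition1 , _ , 2s∉±2 , _) → 2s∉±2 (condition1 one)
  where
    open Classification m n 3≤m 6≤n n-even k ℓ ℓ-parity k₀≡1 k-coprime G subgroup transitive preserves
    open Modular n

    by-cases : Dec (2 * s ≈± 2) → Condition1 ⊎ Condition2
    by-cases (yes 2s≈±2) = inj₁ λ i → ≈±⇒∈± (double-k-≈±2 2s≈±2 i)
    by-cases (no 2s≉±2) = inj₂
      ( m-even 2s≉±2
      , (λ 2s∈±2 → 2s≉±2 (∈±⇒≈± 2s∈±2))
      , (λ i even → ≈±⇒∈± (double-k-even i even))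
      , (λ i odd → ≈±⇒∈± (double-k-odd i odd)) )
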